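{- Let $H\in\mathbb{F}_q[T]$ be a monic squarefree polynomial of degree $h$ with $H\notin\{1,T\}$, and let $G\in\mathbb{F}_q[T]$ be coprime to $H$. Write $\theta=\sum_{j<0}\theta_jT^j=\{G/H\}$. Then there is no $i<0$ such that $\theta_j=0$ for all $i-h<j\le i$; that is, the coefficients of $\theta$ contain no $h$ consecutive zeros.
   Context: $G/H$ is viewed in the field $\mathbb{F}_q(T)_\infty=\{\sum_{l<k}a_lT^l: a_l\in\mathbb{F}_q,k\in\mathbb{Z}\}$ of Laurent series in $1/T$. For $\beta=\sum_{l<k}\beta_lT^l$, the fractional part is $\{\beta\}=\sum_{l<0}\beta_lT^l$. -}

module Defs where

open import Level using (Level; _⊔_; suc)
open import Algebra.Bundles using (CommutativeRing)
open import Data.Nat as ℕ using (ℕ; zero)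
open import Data.Fin using (Fin)
open import Data.Integer as ℤ using (ℤ; +_; -[1+_])
open import Data.List using (List; []; _∷_; length)
open import Data.Product using (Σ; ∃; _×_; _,_)
open import Relation.Nullary using (¬_)
open import Relation.Binary.Definitions using (Decidable)

record FiniteField (c ℓ : Level) : Set (suc (c ⊔ ℓ)) where
  field
    commRing : CommutativeRing c ℓ
  open CommutativeRing commRing public
  field
    0≉1      : ¬ (0# ≈ 1#)
    inverse  : ∀ x → ¬ (x ≈ 0#) → ∃ λ y → x * y ≈ 1#
    _≟_      : Decidable _≈_
    size     : ℕ
    enum     : Fin size → Carrier
    enum-onto : ∀ x → ∃ λ i → enum i ≈ x

module Poly {c ℓ : Level} (F : FiniteField c ℓ) where
  open FiniteField F

  -- Polynomials in F[T] as coefficient lists, constant term first.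
  -- Trailing zeros are allowed; equality is coefficientwise.
  Pol : Set c
  Pol = List Carrier

  coeff : Pol → ℕ → Carrier
  coeff []       _       = 0#
  coeff (a ∷ p)  zero    = a
  coeff (a ∷ p)  (ℕ.suc n) = coeff p n

  _≃_ : Pol → Pol → Set ℓ
  p ≃ q = ∀ n → coeff p n ≈ coeff q n

  addP : Pol → Pol → Pol
  addP []      q       = q
  addP p       []      = p
  addP (a ∷ p) (b ∷ q) = (a + b) ∷ addP p q

  scale : Carrier → Pol → Pol
  scale a []      = []
  scale a (b ∷ p) = (a * b) ∷ scale a p

  mulP : Pol → Pol → Pol
  mulP []      q = []
  mulP (a ∷ p) q = addP (scale a q) (0# ∷ mulP p q)

  oneP : Pol
  oneP = 1# ∷ []

  TP : Pol
  TP = 0# ∷ 1# ∷ []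

  _∣_ : Pol → Pol → Set (c ⊔ ℓ)
  p ∣ q = ∃ λ r → mulP p r ≃ q

  IsUnit : Pol → Set (c ⊔ ℓ)
  IsUnit p = ∃ λ r → mulP p r ≃ oneP

  MonicOfDegree : Pol → ℕ → Set ℓ
  MonicOfDegree p h = (coeff p h ≈ 1#) × (∀ n → h ℕ.< n → coeff p n ≈ 0#)

  Squarefree : Pol → Set (c ⊔ ℓ)
  Squarefree p = ∀ d → mulP d d ∣ p → IsUnit d

  Coprime : Pol → Pol → Set (c ⊔ ℓ)
  Coprime p q = ∀ d → d ∣ p → d ∣ q → IsUnit d

  coeffℤ : Pol → ℤ → Carrier
  coeffℤ p (+ n)    = coeff p n
  coeffℤ p -[1+ n ] = 0#

  -- Laurent series in 1/T: coefficient functions ℤ → F vanishing above some index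
  BoundedAbove : (ℤ → Carrier) → Set ℓ
  BoundedAbove s = ∃ λ k → ∀ l → k ℤ.≤ l → s l ≈ 0#

  -- coefficient of T^m in the product p · s  (p polynomial, s Laurent series)
  mulPL : Pol → (ℤ → Carrier) → ℤ → Carrier
  mulPL []      s m = 0#
  mulPL (a ∷ p) s m = (a * s m) + mulPL p (λ l → s (l ℤ.- ℤ.+ 1)) m

module Submission where

open import Defs
open import Data.Nat using (ℕ)
open import Data.Integer using (ℤ; +_; _<_; _≤_; 0ℤ)
import Data.Integer as Z
open import Data.Product using (Σ; _×_)
open import Relation.Nullary using (¬_)
open import Level using (Level)

import Data.Nat as N
import Data.Nat.Properties as NP
open import Data.Nat.Induction using (<-rec)
import Data.Integer.Properties as ZP
open import Data.Integer.Base using (-[1+_]; +≤+; -≤-; -≤+; -<-; +<+)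
open import Data.Integer.Tactic.RingSolver using (solve-∀)
open import Data.List using ([]; _∷_; applyUpTo)
open import Data.Product using (_,_; ∃)
open import Data.Sum using (_⊎_; inj₁; inj₂)
open import Data.Empty using (⊥; ⊥-elim)
open import Function using (_∘_)
open import Relation.Nullary using (Dec; yes; no)
open import Relation.Binary.Definitions using (tri<; tri≈; tri>)
open import Relation.Binary.PropositionalEquality as P using (_≡_; _≢_)

-- Let s be the Laurent series with H·s = G.  As H is monic of
-- degree h, the (zero) coefficient of T^m, m < 0, in H·s expresses s_{m-h}
-- through s_{m-h+1}, …, s_m; hence a run of h zeros at negative degrees
-- propagates downwards and s vanishes in every degree ≤ i.  If the constant
-- term of H is invertible, the same equations read upwards show that s has no
-- terms of negative degree at all, so s is a polynomial r with H·r = G; then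
-- H ∣ G, H is a unit by coprimality, and a monic unit is 1.  If the constant
-- term vanishes, H = T·H' where H'(0) ≠ 0 (otherwise T² ∣ H, contradicting
-- squarefreeness); the same argument for H' and the series T·s gives H' = 1,
-- i.e. H = T.

sub-suc : ∀ m k → (m Z.- + k) Z.- + 1 ≡ m Z.- + N.suc k
sub-suc m k = identity m (+ k)
  where identity : ∀ m x → (m Z.- x) Z.- Z.1ℤ ≡ m Z.- (Z.1ℤ Z.+ x)
        identity = solve-∀

sub-one-comm : ∀ m k → (m Z.- + k) Z.- + 1 ≡ (m Z.- + 1) Z.- + k
sub-one-comm m k = identity m (+ k)
  where identity : ∀ m x → (m Z.- x) Z.- Z.1ℤ ≡ (m Z.- Z.1ℤ) Z.- x
        identity = solve-∀

neg-sub : ∀ n k → -[1+ n ] Z.- + k ≡ -[1+ (n N.+ k) ]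
neg-sub n k = identity (+ n) (+ k)
  where identity : ∀ x y → (Z.- (Z.1ℤ Z.+ x)) Z.- y ≡ Z.- (Z.1ℤ Z.+ (x Z.+ y))
        identity = solve-∀

suc-pred : ∀ K → (K Z.+ + 1) Z.- + 1 ≡ K
suc-pred = solve-∀

pos-sub : ∀ a b → b N.≤ a → + a Z.- + b ≡ + (a N.∸ b)
pos-sub a b b≤a = P.trans (ZP.m-n≡m⊖n a b) (ZP.⊖-≥ b≤a)

≤-abs : ∀ K → K ≤ + Z.∣ K ∣
≤-abs (+ n)    = ZP.≤-refl
≤-abs -[1+ n ] = -≤+

module SeriesLemmas {c ℓ : Level} (F : FiniteField c ℓ) where
  open FiniteField F
  open Poly F
  open import Relation.Binary.Reasoning.Setoid setoid

  invertible-cancel : ∀ a y x → a * y ≈ 1# → a * x ≈ 0# → x ≈ 0#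
  invertible-cancel a y x ay≈1 ax≈0 = begin
    x           ≈⟨ sym (*-identityˡ x) ⟩
    1# * x      ≈⟨ *-cong (trans (sym ay≈1) (*-comm a y)) refl ⟩
    (y * a) * x ≈⟨ *-assoc y a x ⟩
    y * (a * x) ≈⟨ *-cong refl ax≈0 ⟩
    y * 0#      ≈⟨ zeroʳ y ⟩
    0#          ∎

  one-cancel : ∀ a x → a ≈ 1# → a * x ≈ 0# → x ≈ 0#
  one-cancel a x a≈1 = invertible-cancel a 1# x (trans (*-identityʳ a) a≈1)

  -- The series T·f; mulPL (a ∷ p) f unfolds to a·f + p·(T·f).
  mulT : (ℤ → Carrier) → ℤ → Carrier
  mulT f l = f (l Z.- + 1)

  TermVanishes : Pol → (ℤ → Carrier) → ℤ → ℕ → Set ℓ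
  TermVanishes p f m k = coeff p k ≈ 0# ⊎ f (m Z.- + k) ≈ 0#

  term-vanishes-mulT : ∀ a p f m k → TermVanishes (a ∷ p) f m (N.suc k) → TermVanishes p (mulT f) m k
  term-vanishes-mulT a p f m k (inj₁ pk≈0) = inj₁ pk≈0
  term-vanishes-mulT a p f m k (inj₂ f≈0)  = inj₂ (P.subst (λ x → f x ≈ 0#) (P.sym (sub-suc m k)) f≈0)

  head-term-zero : ∀ a p f m → TermVanishes (a ∷ p) f m 0 → a * f m ≈ 0#
  head-term-zero a p f m (inj₁ a≈0) = trans (*-cong a≈0 refl) (zeroˡ _)
  head-term-zero a p f m (inj₂ f≈0) =
    trans (*-cong refl (P.subst (λ x → f x ≈ 0#) (ZP.+-identityʳ m) f≈0)) (zeroʳ a)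

  mulPL-zero : ∀ p f m → (∀ k → TermVanishes p f m k) → mulPL p f m ≈ 0#
  mulPL-zero []      f m _      = refl
  mulPL-zero (a ∷ p) f m vanish = begin
    a * f m + mulPL p (mulT f) m
      ≈⟨ +-cong (head-term-zero a p f m (vanish 0))
                (mulPL-zero p (mulT f) m (λ k → term-vanishes-mulT a p f m k (vanish (N.suc k)))) ⟩
    0# + 0# ≈⟨ +-identityʳ 0# ⟩
    0#      ∎

  mulPL-single : ∀ p f m e → (∀ k → k ≢ e → TermVanishes p f m k) →
                 mulPL p f m ≈ coeff p e * f (m Z.- + e)
  mulPL-single []      f m e       _      = sym (zeroˡ _)
  mulPL-single (a ∷ p) f m N.zero  vanish = begin
    a * f m + mulPL p (mulT f) m
      ≈⟨ +-cong refl (mulPL-zero p (mulT f) m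
                       (λ k → term-vanishes-mulT a p f m k (vanish (N.suc k) λ ()))) ⟩
    a * f m + 0#      ≈⟨ +-identityʳ _ ⟩
    a * f m           ≈⟨ *-cong refl (reflexive (P.cong f (P.sym (ZP.+-identityʳ m)))) ⟩
    a * f (m Z.- + 0) ∎
  mulPL-single (a ∷ p) f m (N.suc e) vanish = begin
    a * f m + mulPL p (mulT f) m
      ≈⟨ +-cong (head-term-zero a p f m (vanish 0 λ ()))
                (mulPL-single p (mulT f) m e
                   (λ k k≢e → term-vanishes-mulT a p f m k (vanish (N.suc k) (k≢e ∘ NP.suc-injective)))) ⟩
    0# + coeff p e * mulT f (m Z.- + e) ≈⟨ +-identityˡ _ ⟩
    coeff p e * mulT f (m Z.- + e)      ≈⟨ *-cong refl (reflexive (P.cong f (sub-suc m e))) ⟩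
    coeff p e * f (m Z.- + N.suc e)     ∎

  mulPL-cong : ∀ p f g m m' → (∀ k → f (m Z.- + k) ≈ g (m' Z.- + k)) → mulPL p f m ≈ mulPL p g m'
  mulPL-cong []      f g m m' _   = refl
  mulPL-cong (a ∷ p) f g m m' f≈g = +-cong (*-cong refl head) (mulPL-cong p (mulT f) (mulT g) m m' tail)
    where
    head : f m ≈ g m'
    head = P.subst₂ _≈_ (P.cong f (ZP.+-identityʳ m)) (P.cong g (ZP.+-identityʳ m')) (f≈g 0)
    tail : ∀ k → mulT f (m Z.- + k) ≈ mulT g (m' Z.- + k)
    tail k = P.subst₂ _≈_ (P.cong f (P.sym (sub-suc m k))) (P.cong g (P.sym (sub-suc m' k))) (f≈g (N.suc k))

  mulPL-mulT : ∀ p f m → mulPL p (mulT f) m ≈ mulPL p f (m Z.- + 1)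
  mulPL-mulT p f m = mulPL-cong p (mulT f) f m (m Z.- + 1) λ k → reflexive (P.cong f (sub-one-comm m k))

  coeff-addP : ∀ p q n → coeff (addP p q) n ≈ coeff p n + coeff q n
  coeff-addP []      q       n         = sym (+-identityˡ _)
  coeff-addP (a ∷ p) []      n         = sym (+-identityʳ _)
  coeff-addP (a ∷ p) (b ∷ q) N.zero    = refl
  coeff-addP (a ∷ p) (b ∷ q) (N.suc n) = coeff-addP p q n

  coeff-scale : ∀ a p n → coeff (scale a p) n ≈ a * coeff p n
  coeff-scale a []      n         = sym (zeroʳ a)
  coeff-scale a (b ∷ p) N.zero    = refl
  coeff-scale a (b ∷ p) (N.suc n) = coeff-scale a p n

  coeffℤ-addP : ∀ p q x → coeffℤ (addP p q) x ≈ coeffℤ p x + coeffℤ q x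
  coeffℤ-addP p q (+ n)    = coeff-addP p q n
  coeffℤ-addP p q -[1+ n ] = sym (+-identityʳ _)

  coeffℤ-scale : ∀ a p x → coeffℤ (scale a p) x ≈ a * coeffℤ p x
  coeffℤ-scale a p (+ n)    = coeff-scale a p n
  coeffℤ-scale a p -[1+ n ] = sym (zeroʳ a)

  coeffℤ-nil : ∀ x → coeffℤ [] x ≈ 0#
  coeffℤ-nil (+ n)    = refl
  coeffℤ-nil -[1+ n ] = refl

  coeffℤ-cons-zero : ∀ a q x → a ≈ 0# → coeffℤ (a ∷ q) x ≈ coeffℤ q (x Z.- + 1)
  coeffℤ-cons-zero a q (+ N.zero)    a≈0 = a≈0
  coeffℤ-cons-zero a q (+ N.suc n)   _   = refl
  coeffℤ-cons-zero a q -[1+ n ]      _   = refl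

  coeffℤ-mulP : ∀ p q x → coeffℤ (mulP p q) x ≈ mulPL p (coeffℤ q) x
  coeffℤ-mulP []      q x = coeffℤ-nil x
  coeffℤ-mulP (a ∷ p) q x = begin
    coeffℤ (addP (scale a q) (0# ∷ mulP p q)) x      ≈⟨ coeffℤ-addP _ _ x ⟩
    coeffℤ (scale a q) x + coeffℤ (0# ∷ mulP p q) x
      ≈⟨ +-cong (coeffℤ-scale a q x) (coeffℤ-cons-zero 0# _ x refl) ⟩
    a * coeffℤ q x + coeffℤ (mulP p q) (x Z.- + 1)   ≈⟨ +-cong refl (coeffℤ-mulP p q _) ⟩
    a * coeffℤ q x + mulPL p (coeffℤ q) (x Z.- + 1)  ≈⟨ +-cong refl (sym (mulPL-mulT p (coeffℤ q) x)) ⟩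
    mulPL (a ∷ p) (coeffℤ q) x                       ∎

  mulPL-one : ∀ p m → mulPL p (coeffℤ oneP) m ≈ coeffℤ p m
  mulPL-one []      m = sym (coeffℤ-nil m)
  mulPL-one (a ∷ p) m = trans (+-cong refl (trans (mulPL-mulT p _ m) (mulPL-one p _))) (unfold m)
    where
    unfold : ∀ m → a * coeffℤ oneP m + coeffℤ p (m Z.- + 1) ≈ coeffℤ (a ∷ p) m
    unfold (+ N.zero)  = trans (+-identityʳ _) (*-identityʳ a)
    unfold (+ N.suc n) = trans (+-cong (zeroʳ a) refl) (+-identityˡ _)
    unfold -[1+ n ]    = trans (+-cong (zeroʳ a) refl) (+-identityˡ _)

  highest-nonzero : ∀ r → (∀ j → coeff r j ≈ 0#) ⊎
                    ∃ λ m → (¬ coeff r m ≈ 0#) × (∀ j → m N.< j → coeff r j ≈ 0#)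
  highest-nonzero [] = inj₁ λ j → refl
  highest-nonzero (a ∷ r) with highest-nonzero r
  ... | inj₂ (m , rm≉0 , above) = inj₂ (N.suc m , rm≉0 , λ { (N.suc j) (N.s≤s m<j) → above j m<j })
  ... | inj₁ r≈0 with a ≟ 0#
  ...   | yes a≈0 = inj₁ λ { N.zero → a≈0 ; (N.suc j) → r≈0 j }
  ...   | no a≉0  = inj₂ (0 , a≉0 , λ { (N.suc j) _ → r≈0 j })

  -- A monic polynomial of positive degree d is not a unit: if r has top
  -- coefficient r_m ≠ 0, the coefficient of T^{d+m} in p·r is r_m.
  positive-degree-nonunit : ∀ p e → MonicOfDegree p (N.suc e) → ¬ IsUnit p
  positive-degree-nonunit p e (lead , above) (r , pr≃1) with highest-nonzero r
  ... | inj₁ r≈0 = 0≉1 (begin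
    0#                       ≈⟨ sym (mulPL-zero p (coeffℤ r) (+ 0) λ k → inj₂ (r≈0ℤ (+ 0 Z.- + k))) ⟩
    mulPL p (coeffℤ r) (+ 0) ≈⟨ sym (coeffℤ-mulP p r (+ 0)) ⟩
    coeff (mulP p r) 0       ≈⟨ pr≃1 0 ⟩
    1#                       ∎)
    where
    r≈0ℤ : ∀ x → coeffℤ r x ≈ 0#
    r≈0ℤ (+ n)    = r≈0 n
    r≈0ℤ -[1+ n ] = refl
  ... | inj₂ (m , rm≉0 , r-above) = rm≉0 (one-cancel (coeff p d) _ lead (begin
    coeff p d * coeff r m                ≈⟨ *-cong refl (reflexive (P.cong (coeffℤ r) (P.sym d+m-d))) ⟩
    coeff p d * coeffℤ r (+ (d N.+ m) Z.- + d)
                                         ≈⟨ sym (mulPL-single p (coeffℤ r) (+ (d N.+ m)) d other-terms) ⟩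
    mulPL p (coeffℤ r) (+ (d N.+ m))     ≈⟨ sym (coeffℤ-mulP p r (+ (d N.+ m))) ⟩
    coeff (mulP p r) (d N.+ m)           ≈⟨ pr≃1 (d N.+ m) ⟩
    0#                                   ∎))
    where
    d = N.suc e
    d+m-d : + (d N.+ m) Z.- + d ≡ + m
    d+m-d = P.trans (pos-sub (d N.+ m) d (NP.m≤m+n d m)) (P.cong +_ (NP.m+n∸m≡n d m))
    other-terms : ∀ k → k ≢ d → TermVanishes p (coeffℤ r) (+ (d N.+ m)) k
    other-terms k k≢d with NP.<-cmp k d
    ... | tri≈ _ k≡d _ = ⊥-elim (k≢d k≡d)
    ... | tri> _ _ d<k = inj₁ (above k d<k)
    ... | tri< k<d _ _ = inj₂ (P.subst (λ x → coeffℤ r x ≈ 0#) (P.sym (pos-sub (d N.+ m) k k≤d+m))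
                                      (r-above (d N.+ m N.∸ k) m<d+m-k))
      where
      k≤d+m : k N.≤ d N.+ m
      k≤d+m = NP.≤-trans (NP.<⇒≤ k<d) (NP.m≤m+n d m)
      m<d+m-k : m N.< d N.+ m N.∸ k
      m<d+m-k = NP.+-cancelˡ-< k m (d N.+ m N.∸ k)
                  (P.subst (λ z → k N.+ m N.< z) (P.sym (NP.m+[n∸m]≡n k≤d+m)) (NP.+-monoˡ-< m k<d))

  monic-unit⇒one : ∀ p h → MonicOfDegree p h → IsUnit p → p ≃ oneP
  monic-unit⇒one p N.zero    (lead , _)     _    N.zero    = lead
  monic-unit⇒one p N.zero    (_    , above) _    (N.suc n) = above (N.suc n) (N.s≤s N.z≤n)
  monic-unit⇒one p (N.suc e) monic          unit           = ⊥-elim (positive-degree-nonunit p e monic unit)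

  T-nonunit : ¬ IsUnit TP
  T-nonunit = positive-degree-nonunit TP 0
                (refl , λ { (N.suc (N.suc n)) _ → refl ; (N.suc N.zero) (N.s≤s ()) })

  ∣-refl : ∀ p → p ∣ p
  ∣-refl p = oneP , λ n → trans (coeffℤ-mulP p oneP (+ n)) (mulPL-one p (+ n))

  -- The tail of p; when p(0) = 0 it is the quotient p / T.
  divT : Pol → Pol
  divT []      = []
  divT (a ∷ p) = p

  coeffℤ-divT : ∀ p → coeff p 0 ≈ 0# → ∀ x → coeffℤ p x ≈ coeffℤ (divT p) (x Z.- + 1)
  coeffℤ-divT []      _    x = trans (coeffℤ-nil x) (sym (coeffℤ-nil (x Z.- + 1)))
  coeffℤ-divT (a ∷ p) a≈0  x = coeffℤ-cons-zero a p x a≈0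

  coeff-divT : ∀ p n → coeff (divT p) n ≡ coeff p (N.suc n)
  coeff-divT []      n = P.refl
  coeff-divT (a ∷ p) n = P.refl

  divT-divides : ∀ p → coeff p 0 ≈ 0# → divT p ∣ p
  divT-divides p p0≈0 = TP , λ n → begin
    coeff (mulP (divT p) TP) n                   ≈⟨ coeffℤ-mulP (divT p) TP (+ n) ⟩
    mulPL (divT p) (coeffℤ TP) (+ n)
      ≈⟨ mulPL-cong (divT p) (coeffℤ TP) (coeffℤ oneP) (+ n) (+ n Z.- + 1) (T-is-shift (+ n)) ⟩
    mulPL (divT p) (coeffℤ oneP) (+ n Z.- + 1)   ≈⟨ mulPL-one (divT p) _ ⟩
    coeffℤ (divT p) (+ n Z.- + 1)                ≈⟨ sym (coeffℤ-divT p p0≈0 (+ n)) ⟩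
    coeff p n                                    ∎
    where
    T-is-shift : ∀ m k → coeffℤ TP (m Z.- + k) ≈ coeffℤ oneP ((m Z.- + 1) Z.- + k)
    T-is-shift m k = trans (coeffℤ-cons-zero 0# oneP (m Z.- + k) refl)
                           (reflexive (P.cong (coeffℤ oneP) (sub-one-comm m k)))

  mulPL-T² : ∀ f m → mulPL (mulP TP TP) f m ≈ f ((m Z.- + 1) Z.- + 1)
  mulPL-T² f m = begin
    mulPL (mulP TP TP) f m              ≈⟨ mulPL-single (mulP TP TP) f m 2 other-terms ⟩
    coeff (mulP TP TP) 2 * f (m Z.- + 2) ≈⟨ *-cong (*-identityˡ 1#) (reflexive (P.cong f (P.sym (sub-suc m 1)))) ⟩
    1# * f ((m Z.- + 1) Z.- + 1)        ≈⟨ *-identityˡ _ ⟩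
    f ((m Z.- + 1) Z.- + 1)             ∎
    where
    other-terms : ∀ k → k ≢ 2 → TermVanishes (mulP TP TP) f m k
    other-terms N.zero                      _   = inj₁ (trans (+-identityʳ _) (zeroˡ _))
    other-terms (N.suc N.zero)              _   =
      inj₁ (trans (+-cong (zeroˡ _) (trans (+-identityʳ _) (zeroʳ _))) (+-identityˡ 0#))
    other-terms (N.suc (N.suc N.zero))      k≢2 = ⊥-elim (k≢2 P.refl)
    other-terms (N.suc (N.suc (N.suc k)))   _   = inj₁ refl

  T²-divides : ∀ p → coeff p 0 ≈ 0# → coeff (divT p) 0 ≈ 0# → mulP TP TP ∣ p
  T²-divides p p0≈0 p1≈0 = divT (divT p) , λ n → begin
    coeff (mulP (mulP TP TP) (divT (divT p))) n             ≈⟨ coeffℤ-mulP (mulP TP TP) _ (+ n) ⟩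
    mulPL (mulP TP TP) (coeffℤ (divT (divT p))) (+ n)       ≈⟨ mulPL-T² (coeffℤ (divT (divT p))) (+ n) ⟩
    coeffℤ (divT (divT p)) ((+ n Z.- + 1) Z.- + 1)          ≈⟨ sym (coeffℤ-divT (divT p) p1≈0 (+ n Z.- + 1)) ⟩
    coeffℤ (divT p) (+ n Z.- + 1)                           ≈⟨ sym (coeffℤ-divT p p0≈0 (+ n)) ⟩
    coeff p n                                               ∎

  mulPL-divT : ∀ p f m → coeff p 0 ≈ 0# → mulPL p f m ≈ mulPL (divT p) (mulT f) m
  mulPL-divT []      f m _   = refl
  mulPL-divT (a ∷ p) f m a≈0 = trans (+-cong (trans (*-cong a≈0 refl) (zeroˡ _)) refl) (+-identityˡ _)

  monic-divT : ∀ p h → MonicOfDegree p (N.suc h) → MonicOfDegree (divT p) h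
  monic-divT p h (lead , above) =
    P.subst (_≈ 1#) (P.sym (coeff-divT p h)) lead ,
    λ n h<n → P.subst (_≈ 0#) (P.sym (coeff-divT p n)) (above (N.suc n) (N.s≤s h<n))

  divT≃one⇒≃T : ∀ p → coeff p 0 ≈ 0# → divT p ≃ oneP → p ≃ TP
  divT≃one⇒≃T p p0≈0 _   N.zero    = p0≈0
  divT≃one⇒≃T p _    q≃1 (N.suc n) = P.subst (_≈ coeffℤ oneP (+ n)) (coeff-divT p n) (q≃1 n)

  -- Laurent series.  f has no terms of degree < -k0, i.e. f_{-(N+1)} = 0 for N ≥ k0.
  VanishesFrom : ℕ → (ℤ → Carrier) → Set ℓ
  VanishesFrom k0 f = ∀ N → k0 N.≤ N → f -[1+ N ] ≈ 0#

  IntegralProduct : Pol → (ℤ → Carrier) → Set ℓ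
  IntegralProduct p f = ∀ k → mulPL p f -[1+ k ] ≈ 0#

  mulT-bounded : ∀ f → BoundedAbove f → BoundedAbove (mulT f)
  mulT-bounded f (K , above) = K Z.+ + 1 , λ l K+1≤l →
    above (l Z.- + 1) (P.subst (_≤ l Z.- + 1) (suc-pred K) (ZP.+-monoˡ-≤ (Z.- + 1) K+1≤l))

  mulT-vanishes : ∀ k0 f → VanishesFrom k0 f → VanishesFrom k0 (mulT f)
  mulT-vanishes k0 f van N k0≤N =
    van (N.suc (N N.+ 0)) (NP.≤-trans k0≤N (NP.≤-trans (NP.m≤m+n N 0) (NP.n≤1+n _)))

  -- Read upwards: if p(0) is invertible, the equation at degree -(k+1)
  -- determines f_{-(k+1)} from lower coefficients, so f vanishes at all
  -- negative degrees once it vanishes below some degree.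
  vanish-upward-step : ∀ p f y k → coeff p 0 * y ≈ 1# → IntegralProduct p f →
                       VanishesFrom (N.suc k) f → VanishesFrom k f
  vanish-upward-step p f y k p0y≈1 integral van N k≤N with NP.m≤n⇒m<n∨m≡n k≤N
  ... | inj₁ k<N   = van N k<N
  ... | inj₂ P.refl = invertible-cancel (coeff p 0) y (f -[1+ k ]) p0y≈1 (begin
    coeff p 0 * f -[1+ k ]             ≈⟨ *-cong refl (reflexive (P.cong f (P.sym (ZP.+-identityʳ _)))) ⟩
    coeff p 0 * f (-[1+ k ] Z.- + 0)   ≈⟨ sym (mulPL-single p f -[1+ k ] 0 lower-terms) ⟩
    mulPL p f -[1+ k ]                 ≈⟨ integral k ⟩
    0#                                 ∎)
    where
    lower-terms : ∀ t → t ≢ 0 → TermVanishes p f -[1+ k ] t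
    lower-terms N.zero    t≢0 = ⊥-elim (t≢0 P.refl)
    lower-terms (N.suc t) _   = inj₂ (P.subst (λ x → f x ≈ 0#) (P.sym (neg-sub k (N.suc t)))
                                  (van (k N.+ N.suc t) (P.subst (N.suc k N.≤_) (P.sym (NP.+-suc k t))
                                                                (N.s≤s (NP.m≤m+n k t)))))

  vanish-upward : ∀ p f y k0 → coeff p 0 * y ≈ 1# → IntegralProduct p f →
                  VanishesFrom k0 f → VanishesFrom 0 f
  vanish-upward p f y N.zero      _     _        van = van
  vanish-upward p f y (N.suc k0)  p0y≈1 integral van =
    vanish-upward p f y k0 p0y≈1 integral (vanish-upward-step p f y k0 p0y≈1 integral van)

  -- Read downwards: for monic p of degree h, the equation at degree -(M+1)
  -- determines f_{-(M+h+1)} from the h coefficients above it.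
  vanish-downward-step : ∀ p f h M → MonicOfDegree p h → IntegralProduct p f →
                         (∀ k → k N.< h → f -[1+ (M N.+ k) ] ≈ 0#) → f -[1+ (M N.+ h) ] ≈ 0#
  vanish-downward-step p f h M (lead , above) integral run = one-cancel (coeff p h) _ lead (begin
    coeff p h * f -[1+ (M N.+ h) ]   ≈⟨ *-cong refl (reflexive (P.cong f (P.sym (neg-sub M h)))) ⟩
    coeff p h * f (-[1+ M ] Z.- + h) ≈⟨ sym (mulPL-single p f -[1+ M ] h other-terms) ⟩
    mulPL p f -[1+ M ]               ≈⟨ integral M ⟩
    0#                               ∎)
    where
    other-terms : ∀ k → k ≢ h → TermVanishes p f -[1+ M ] k
    other-terms k k≢h with NP.<-cmp k h
    ... | tri≈ _ k≡h _ = ⊥-elim (k≢h k≡h)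
    ... | tri> _ _ h<k = inj₁ (above k h<k)
    ... | tri< k<h _ _ = inj₂ (P.subst (λ x → f x ≈ 0#) (P.sym (neg-sub M k)) (run k k<h))

  vanish-downward : ∀ p f h k0 → MonicOfDegree p h → IntegralProduct p f →
                    (∀ N → k0 N.≤ N → N N.< k0 N.+ h → f -[1+ N ] ≈ 0#) → VanishesFrom k0 f
  vanish-downward p f h k0 monic integral window = <-rec _ step
    where
    step : ∀ N → (∀ {N'} → N' N.< N → k0 N.≤ N' → f -[1+ N' ] ≈ 0#) → k0 N.≤ N → f -[1+ N ] ≈ 0#
    step N below k0≤N with N N.<? k0 N.+ h
    ... | yes N<k0+h = window N k0≤N N<k0+h
    ... | no  N≮k0+h = P.subst (λ n → f -[1+ n ] ≈ 0#) (NP.m∸n+n≡m h≤N)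
                         (vanish-downward-step p f h M monic integral run)
      where
      k0+h≤N : k0 N.+ h N.≤ N
      k0+h≤N = NP.≮⇒≥ N≮k0+h
      h≤N : h N.≤ N
      h≤N = NP.≤-trans (NP.m≤n+m h k0) k0+h≤N
      M = N N.∸ h
      k0≤M : k0 N.≤ M
      k0≤M = NP.≤-trans (NP.≤-reflexive (P.sym (NP.m+n∸n≡m k0 h))) (NP.∸-monoˡ-≤ h k0+h≤N)
      run : ∀ k → k N.< h → f -[1+ (M N.+ k) ] ≈ 0#
      run k k<h = below
        (P.subst (M N.+ k N.<_) (NP.m∸n+n≡m h≤N) (NP.+-monoʳ-< M k<h))
        (NP.≤-trans k0≤M (NP.m≤m+n M k))

  -- A series bounded above without negative-degree terms is a polynomial r;
  -- so p·f = G means p·r = G and p ∣ G.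
  polynomial-series-divides : ∀ p G f → BoundedAbove f → VanishesFrom 0 f →
                              (∀ m → mulPL p f m ≈ coeffℤ G m) → p ∣ G
  polynomial-series-divides p G f (K , above) van eq =
    r , λ n → trans (coeffℤ-mulP p r (+ n))
                    (trans (mulPL-cong p (coeffℤ r) f (+ n) (+ n) (λ k → r≈f _)) (eq (+ n)))
    where
    truncation : ∀ g n → (∀ j → n N.≤ j → g j ≈ 0#) → ∀ j → coeff (applyUpTo g n) j ≈ g j
    truncation g N.zero    g-above j         = sym (g-above j N.z≤n)
    truncation g (N.suc n) g-above N.zero    = refl
    truncation g (N.suc n) g-above (N.suc j) =
      truncation (g ∘ N.suc) n (λ j n≤j → g-above (N.suc j) (N.s≤s n≤j)) j
    r = applyUpTo (λ n → f (+ n)) Z.∣ K ∣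
    r≈f : ∀ x → coeffℤ r x ≈ f x
    r≈f (+ n)    =
      truncation (λ n → f (+ n)) Z.∣ K ∣ (λ j le → above (+ j) (ZP.≤-trans (≤-abs K) (+≤+ le))) n
    r≈f -[1+ n ] = sym (van n N.z≤n)

  cofactor-unit : ∀ D H G f k0 → D ∣ H → Coprime G H → ¬ coeff D 0 ≈ 0# → BoundedAbove f →
                  (∀ m → mulPL D f m ≈ coeffℤ G m) → VanishesFrom k0 f → IsUnit D
  cofactor-unit D H G f k0 D∣H coprime D0≉0 bounded eq van with inverse (coeff D 0) D0≉0
  ... | y , D0y≈1 = coprime D (polynomial-series-divides D G f bounded
                      (vanish-upward D f y k0 D0y≈1 (λ k → eq -[1+ k ]) van) eq) D∣H

  -- If H(0) = 0, then H = T·H' with H' monic, H'(0) ≠ 0 by squarefreeness,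
  -- and H' is the unit 1 by cofactor-unit applied to the series T·s.
  zero-constant-term⇒T : ∀ H G h s k0 → MonicOfDegree H h → Squarefree H → Coprime G H →
                         coeff H 0 ≈ 0# → BoundedAbove s → (∀ m → mulPL H s m ≈ coeffℤ G m) →
                         VanishesFrom k0 s → H ≃ TP
  zero-constant-term⇒T H G N.zero s k0 (lead , _) _ _ H0≈0 _ _ _ = ⊥-elim (0≉1 (trans (sym H0≈0) lead))
  zero-constant-term⇒T H G (N.suc h) s k0 monic sqf coprime H0≈0 bounded eq van with coeff (divT H) 0 ≟ 0#
  ... | yes H1≈0 = ⊥-elim (T-nonunit (sqf TP (T²-divides H H0≈0 H1≈0)))
  ... | no  H1≉0 = divT≃one⇒≃T H H0≈0 (monic-unit⇒one (divT H) h (monic-divT H h monic) H'-unit)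
    where
    H'-unit : IsUnit (divT H)
    H'-unit = cofactor-unit (divT H) H G (mulT s) k0 (divT-divides H H0≈0) coprime H1≉0
                (mulT-bounded s bounded) (λ m → trans (sym (mulPL-divT H s m H0≈0)) (eq m))
                (mulT-vanishes k0 s van)

lemma3p1 : {c ℓ : Level} (F : FiniteField c ℓ) →
    let open FiniteField F in
    let open Poly F in
    (H G : Pol) (h : ℕ) →
    MonicOfDegree H h → Squarefree H →
    ¬ (H ≃ oneP) → ¬ (H ≃ TP) →
    Coprime G H →
    (s : ℤ → Carrier) → BoundedAbove s →
    (∀ m → mulPL H s m ≈ coeffℤ G m) →
    ¬ (Σ ℤ λ i → (i < 0ℤ) × (∀ j → i Z.- + h < j → j ≤ i → s j ≈ 0#))
lemma3p1 F H G h monic sqf H≄1 H≄T coprime s bounded eq (+ _ , +<+ () , _)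
lemma3p1 F H G h monic sqf H≄1 H≄T coprime s bounded eq (-[1+ k0 ] , _ , run) =
  by-constant-term (coeff H 0 ≟ 0#)
  where
  open FiniteField F
  open Poly F
  open SeriesLemmas F
  van : VanishesFrom k0 s
  van = vanish-downward H s h k0 monic (λ k → eq -[1+ k ]) λ N k0≤N N<k0+h →
          run -[1+ N ] (P.subst (_< -[1+ N ]) (P.sym (neg-sub k0 h)) (-<- N<k0+h)) (-≤- k0≤N)
  by-constant-term : Dec (coeff H 0 ≈ 0#) → ⊥
  by-constant-term (no H0≉0)  = H≄1 (monic-unit⇒one H h monic
                                  (cofactor-unit H H G s k0 (∣-refl H) coprime H0≉0 bounded eq van))
  by-constant-term (yes H0≈0) = H≄T (zero-constant-term⇒T H G h s k0 monic sqf coprime H0≈0 bounded eq van)
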